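{- Let $M$ be a continuous multiline queue of type $m=(m_1,\ldots,m_n)$ with $N=\sum_{i=1}^n S_i$ entries, let $M'=S(M)$, $\omega=\mathbf{B}(M)=(\omega_1,\ldots,\omega_{S_n})$ and $\omega'=\mathbf{B}(M')$. Then: (1) if $N$ is not in the last row of $M$, then $\omega'=\omega$; (2) if $N$ is in the last row of $M$, then $\omega'$ is obtained by rotating $\omega$ one position to the right, i.e. $\omega'=(\omega_{S_n},\omega_1,\ldots,\omega_{S_n-1})$.
   Context: Let $m=(m_1,\ldots,m_n)$ be a tuple of nonnegative integers, $S_i=m_1+\cdots+m_i$ and $N=S_1+\cdots+S_n$. A continuous multiline queue of type $m$ is an array $M$ with $n$ rows in which row $i$ is a strictly increasing sequence $M_{i,1}<\cdots<M_{i,S_i}$ of integers and the $N$ entries are exactly $1,\ldots,N$, each once. Bully path procedure: initially all entries are available. For $r=1,\ldots,n-1$ in turn, every still-available entry of row $r$ starts a bully path: an entry $x$ of row $r'$ on the path bullies the smallest available entry of row $r'+1$ larger than $x$, or, if there is none, the smallest available entry of row $r'+1$ (a wrapping); bullied entries become unavailable and the path continues down to row $n$, whose endpoint gets label $r$. Afterwards, remaining available entries of row $n$ get label $n$. The projected word $\mathbf{B}(M)=(\omega_1,\ldots,\omega_{S_n})$ has $\omega_k$ equal to the label of $M_{n,k}$. Shift operator: $S(M)$ is obtained from $M$ by replacing each entry $x$ by $x+1$ if $x<N$ and replacing $N$ by $1$, and then re-sorting each row into increasing order. -}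

module Defs where

open import Data.Nat using (ℕ; zero; suc; _+_; _<_; _<ᵇ_; _≤ᵇ_)
open import Data.Nat.Properties using (≤-decTotalOrder)
open import Data.Bool using (Bool; true; false; if_then_else_)
open import Data.Maybe using (Maybe; just; nothing)
open import Data.Product using (_×_; _,_)
open import Data.Nat.ListAction using (sum)
open import Data.List using (List; []; _∷_; _++_; map; concat; upTo; reverse; length)
open import Data.List.Relation.Unary.Linked using (Linked)
open import Data.List.Relation.Unary.All using (All)
open import Data.List.Relation.Binary.Permutation.Propositional using (_↭_)
open import Data.Vec using (Vec; toList)
open import Data.List.Sort.InsertionSort ≤-decTotalOrder using (sort)
open import Relation.Binary.PropositionalEquality using (_≡_)

partialSums : List ℕ → List ℕ
partialSums []       = []
partialSums (x ∷ xs) = x ∷ map (x +_) (partialSums xs)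

totalN : ∀ {n} → Vec ℕ n → ℕ
totalN m = sum (partialSums (toList m))

record IsCMLQ {n : ℕ} (m : Vec ℕ n) (M : Vec (List ℕ) n) : Set where
  field
    rowLengths : map length (toList M) ≡ partialSums (toList m)
    rowsIncr   : All (Linked _<_) (toList M)
    entries    : concat (toList M) ↭ map suc (upTo (totalN m))

-- Bully path procedure.  Availability is tracked by keeping, for each
-- row, the list (increasing) of its still-available entries.

-- smallest element of the list satisfying p, together with the list
-- with that element removed (the list is increasing, so "first" = "smallest")
pickFirst : (ℕ → Bool) → List ℕ → Maybe (ℕ × List ℕ)
pickFirst p [] = nothing
pickFirst p (y ∷ ys) with p y
... | true  = just (y , ys)
... | false with pickFirst p ys
...   | nothing         = nothing
...   | just (z , ys')  = just (z , y ∷ ys')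

bully : ℕ → List ℕ → Maybe (ℕ × List ℕ)
bully x row with pickFirst (λ y → x <ᵇ y) row
... | just r  = just r
... | nothing = pickFirst (λ _ → true) row

runPath : ℕ → List (List ℕ) → Maybe ℕ × List (List ℕ)
runPath x [] = just x , []
runPath x (row ∷ rest) with bully x row
... | nothing = nothing , row ∷ rest
... | just (y , row') with runPath y rest
...   | e , rest' = e , row' ∷ rest'

runAll : ℕ → List ℕ → List (List ℕ) → List (ℕ × ℕ) × List (List ℕ)
runAll r [] rest = [] , rest
runAll r (x ∷ xs) rest with runPath x rest
... | nothing , rest1 = runAll r xs rest1
... | just e  , rest1 with runAll r xs rest1
...   | labs , rest2 = (e , r) ∷ labs , rest2

-- On the last row, remaining available entries get label n (= r there).
-- The first argument is fuel (number of rows), so the recursion is structural.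
stages : ℕ → ℕ → List (List ℕ) → List (ℕ × ℕ)
stages _ r [] = []
stages _ r (An ∷ []) = map (λ y → y , r) An
stages zero r (Ar ∷ _ ∷ _) = []
stages (suc fuel) r (Ar ∷ rest@(_ ∷ _)) with runAll r Ar rest
... | labs , rest' = labs ++ stages fuel (suc r) rest'

allLabels : ∀ {n} → Vec (List ℕ) n → List (ℕ × ℕ)
allLabels {n} M = stages n 1 (toList M)

labelOf : ℕ → List (ℕ × ℕ) → ℕ
labelOf y [] = 0
labelOf y ((z , l) ∷ ls) = if (y ≤ᵇ z) Data.Bool.∧ (z ≤ᵇ y) then l else labelOf y ls

projWord : ∀ {k} → Vec (List ℕ) (suc k) → List ℕ
projWord M = map (λ y → labelOf y (allLabels M)) (Data.Vec.last M)

shiftEntry : ℕ → ℕ → ℕ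
shiftEntry N x = if x <ᵇ N then suc x else 1

shiftM : ∀ {n} → ℕ → Vec (List ℕ) n → Vec (List ℕ) n
shiftM N M = Data.Vec.map (λ row → sort (map (shiftEntry N) row)) M

rotateRight : List ℕ → List ℕ
rotateRight xs with reverse xs
... | []     = []
... | y ∷ ys = y ∷ reverse ys

-- Bullying only sees the cyclic order of the entries 1 … N: x bullies the available entry
-- of the next row that comes first cyclically after x. The shift σ rotates this cyclic
-- order, so the bully procedure on S(M) is the σ-image of the procedure on M, provided the
-- paths of each row are started in corresponding order. Rows are processed in increasing
-- order, which σ preserves except that N becomes 1 and moves from last to first. This does
-- not matter, because the paths of a row may be started in any order: two bullies of a row
-- either first hit different entries, and then do not interact, or the same entry, and then
-- their next targets coincide as well; either way swapping them only swaps their endpoints.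
-- Hence σ y receives the label of y, and reading the last row of S(M) in increasing order
-- gives ω, or, when N sits in the last row, ω with its final letter moved to the front.

module Submission where

open import Data.Bool using (true; false; if_then_else_; _∧_; T)
open import Data.Nat using (ℕ; zero; suc; pred; _+_; _≤_; _<_; _≮_; _<ᵇ_; _≤ᵇ_; _<?_; z≤n; s≤s; s≤s⁻¹)
open import Data.Nat.Properties
open import Data.List using (List; []; _∷_; _++_; [_]; map; length; reverse; concat)
open import Data.List.Membership.DecPropositional _≟_ using (_∈?_)
open import Data.List.Membership.Propositional using (_∈_; _∉_)
open import Data.List.Membership.Propositional.Properties
  using (∈-++⁺ˡ; ∈-++⁺ʳ; ∈-++⁻; ∈-map⁺; ∈-map⁻; ∈-concat⁺′; ∈-upTo⁻)
open import Data.List.Properties using (map-id; map-∘; map-++; map-cong-local; reverse-++; reverse-involutive)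
open import Data.List.Relation.Binary.Permutation.Propositional
  using (_↭_; prep; swap; ↭-refl; ↭-sym; ↭-trans; ↭-reflexive; ↭⇒↭ₛ)
  renaming (refl to ↭-refl-con; trans to ↭-trans-con)
open import Data.List.Relation.Binary.Permutation.Propositional.Properties
  using (↭-length; ∈-resp-↭; All-resp-↭; ∷↭∷ʳ)
import Data.List.Relation.Binary.Permutation.Propositional.Properties as ↭
open import Data.List.Relation.Binary.Pointwise using (Pointwise; []; _∷_; Pointwise-≡⇒≡)
open import Data.List.Relation.Binary.Subset.Propositional using (_⊆_)
open import Data.List.Relation.Unary.All as All using (All; []; _∷_)
import Data.List.Relation.Unary.All.Properties as All
open import Data.List.Relation.Unary.AllPairs using (AllPairs; []; _∷_)
open import Data.List.Relation.Unary.Any using (here; there)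
open import Data.List.Relation.Unary.Linked as Linked using (Linked; []; [-]; _∷_)
import Data.List.Relation.Unary.Linked.Properties as Linked
open import Data.List.Relation.Unary.Sorted.TotalOrder.Properties using (↗↭↗⇒≋)
open import Data.Maybe using (just; nothing)
open import Data.Maybe.Relation.Binary.Pointwise using (just; nothing) renaming (Pointwise to MaybeRel)
open import Data.List.Sort.InsertionSort ≤-decTotalOrder using (sort)
import Data.List.Sort.InsertionSort.Properties ≤-decTotalOrder as Sort
open import Data.Product using (Σ; ∃; ∃₂; _×_; _,_; proj₁; proj₂; uncurry)
open import Data.Sum using (_⊎_; inj₁; inj₂)
open import Data.Vec using (Vec; last; toList; []; _∷_)
import Data.Vec as Vec
open import Data.Vec.Properties using (toList-map)
open import Function using (_∘_; case_of_)
open import Relation.Binary.PropositionalEquality hiding ([_])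
open ≡-Reasoning
open import Relation.Nullary using (¬_; yes; no; contradiction)
open import Relation.Nullary.Reflects using (Reflects; ofʸ; ofⁿ; fromEquivalence)

open import Defs

<ᵇ-true : ∀ {x y} → x < y → (x <ᵇ y) ≡ true
<ᵇ-true {x} {y} x<y with x <ᵇ y | <ᵇ-reflects-< x y
... | true  | _        = refl
... | false | ofⁿ x≮y = contradiction x<y x≮y

<ᵇ-false : ∀ {x y} → x ≮ y → (x <ᵇ y) ≡ false
<ᵇ-false {x} {y} x≮y with x <ᵇ y | <ᵇ-reflects-< x y
... | false | _        = refl
... | true  | ofʸ x<y = contradiction x<y x≮y

≤ᵇ∧≥ᵇ-reflects-≡ : ∀ y z → Reflects (y ≡ z) ((y ≤ᵇ z) ∧ (z ≤ᵇ y))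
≤ᵇ∧≥ᵇ-reflects-≡ y z = fromEquivalence to from
  where
  to : T ((y ≤ᵇ z) ∧ (z ≤ᵇ y)) → y ≡ z
  to t with y ≤ᵇ z in eq
  ... | true = ≤-antisym (≤ᵇ⇒≤ y z (subst T (sym eq) _)) (≤ᵇ⇒≤ z y t)
  from : y ≡ z → T ((y ≤ᵇ z) ∧ (z ≤ᵇ y))
  from refl with y ≤ᵇ y | ≤ᵇ-reflects-≤ y y
  ... | true  | _        = _
  ... | false | ofⁿ y≰y = contradiction ≤-refl y≰y

sort-unique : ∀ {xs ys} → Linked _≤_ ys → xs ↭ ys → sort xs ≡ ys
sort-unique {xs} ys↗ xs↭ys =
  Pointwise-≡⇒≡ (↗↭↗⇒≋ ≤-totalOrder (Sort.sort-↗ xs) ys↗ (↭⇒↭ₛ (↭-trans (Sort.sort-↭ xs) xs↭ys)))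

Linked-+⁻ : ∀ k {Ls} → Linked _≤_ (map (k +_) Ls) → Linked _≤_ Ls
Linked-+⁻ k = Linked.map (+-cancelˡ-≤ k _ _) ∘ Linked.map⁻

partialSums-↗ : ∀ xs → Linked _≤_ (partialSums xs)
partialSums-↗ []       = []
partialSums-↗ (x ∷ xs) with partialSums xs | partialSums-↗ xs
... | []    | _  = [-]
... | p ∷ _ | ↗ = m≤m+n x p ∷ Linked.map⁺ (Linked.map (+-monoʳ-≤ x) ↗)

head-≤ : ∀ {a as z} → AllPairs _<_ (a ∷ as) → z ∈ a ∷ as → a ≤ z
head-≤ _           (here refl) = ≤-refl
head-≤ (a<as ∷ _) (there z∈)  = <⇒≤ (All.lookup a<as z∈)

drop-head-⊆ : ∀ {a A B} → All (a <_) A → a ∷ A ⊆ a ∷ B → A ⊆ B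
drop-head-⊆ a<A A⊆B z∈ with A⊆B (there z∈)
... | here refl = contradiction (All.lookup a<A z∈) (n≮n _)
... | there z∈B = z∈B

increasing-ext : ∀ {A B} → AllPairs _<_ A → AllPairs _<_ B → A ⊆ B → B ⊆ A → A ≡ B
increasing-ext {[]}    {[]}    _ _ _   _   = refl
increasing-ext {[]}    {b ∷ B} _ _ _   B⊆A with () ← B⊆A (here refl)
increasing-ext {a ∷ A} {[]}    _ _ A⊆B _   with () ← A⊆B (here refl)
increasing-ext {a ∷ A} {b ∷ B} A↑@(a<A ∷ A′↑) B↑@(b<B ∷ B′↑) A⊆B B⊆A
  with refl ← ≤-antisym (head-≤ A↑ (B⊆A (here refl))) (head-≤ B↑ (A⊆B (here refl)))
  = cong (a ∷_) (increasing-ext A′↑ B′↑ (drop-head-⊆ a<A A⊆B) (drop-head-⊆ b<B B⊆A))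

AllPairs-++⁻ˡ : ∀ {R : ℕ → ℕ → Set} xs {ys} → AllPairs R (xs ++ ys) → AllPairs R xs
AllPairs-++⁻ˡ []       _          = []
AllPairs-++⁻ˡ (x ∷ xs) (px ∷ pxs) = All.++⁻ˡ xs px ∷ AllPairs-++⁻ˡ xs pxs

∈-pre⇒< : ∀ pre {y post z} → AllPairs _<_ (pre ++ y ∷ post) → z ∈ pre → z < y
∈-pre⇒< (a ∷ pre) (a<rest ∷ _) (here refl) = All.lookup a<rest (∈-++⁺ʳ pre (here refl))
∈-pre⇒< (a ∷ pre) (_ ∷ rest↑)  (there z∈)  = ∈-pre⇒< pre rest↑ z∈

∈-post⇒> : ∀ pre {y post z} → AllPairs _<_ (pre ++ y ∷ post) → z ∈ post → y < z
∈-post⇒> []        (y<post ∷ _) z∈ = All.lookup y<post z∈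
∈-post⇒> (a ∷ pre) (_ ∷ rest↑)  z∈ = ∈-post⇒> pre rest↑ z∈

All-remove : ∀ {P : ℕ → Set} pre {y post} → All P (pre ++ y ∷ post) → All P (pre ++ post)
All-remove []        (_ ∷ ps)  = ps
All-remove (a ∷ pre) (pa ∷ ps) = pa ∷ All-remove pre ps

AllPairs-remove : ∀ pre {y post} → AllPairs _<_ (pre ++ y ∷ post) → AllPairs _<_ (pre ++ post)
AllPairs-remove []        (_ ∷ ps)     = ps
AllPairs-remove (a ∷ pre) (a<rest ∷ ps) = All-remove pre a<rest ∷ AllPairs-remove pre ps

∈-remove⁺ : ∀ (pre : List ℕ) {y post z} → z ∈ pre ++ post → z ∈ pre ++ y ∷ post
∈-remove⁺ pre z∈ with ∈-++⁻ pre z∈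
... | inj₁ z∈pre  = ∈-++⁺ˡ z∈pre
... | inj₂ z∈post = ∈-++⁺ʳ pre (there z∈post)

∈-remove-≢ : ∀ pre {y post z} → AllPairs _<_ (pre ++ y ∷ post) → z ∈ pre ++ post → z ≢ y
∈-remove-≢ pre ↑ z∈ refl with ∈-++⁻ pre z∈
... | inj₁ z∈pre  = n≮n _ (∈-pre⇒< pre ↑ z∈pre)
... | inj₂ z∈post = n≮n _ (∈-post⇒> pre ↑ z∈post)

∈-remove⁻ : ∀ (pre : List ℕ) {y post z} → z ∈ pre ++ y ∷ post → z ≢ y → z ∈ pre ++ post
∈-remove⁻ pre z∈ z≢y with ∈-++⁻ pre z∈
... | inj₁ z∈pre          = ∈-++⁺ˡ z∈pre
... | inj₂ (here z≡y)     = contradiction z≡y z≢y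
... | inj₂ (there z∈post) = ∈-++⁺ʳ pre z∈post

length-remove : ∀ pre {y : ℕ} {post} → length (pre ++ y ∷ post) ≡ suc (length (pre ++ post))
length-remove []        = refl
length-remove (a ∷ pre) = cong suc (length-remove pre)

last-∈ : ∀ {A : Set} {n} (v : Vec A (suc n)) → last v ∈ toList v
last-∈ (x ∷ [])     = here refl
last-∈ (x ∷ y ∷ v) = there (last-∈ (y ∷ v))

last-map : ∀ {A B : Set} {n} (f : A → B) (v : Vec A (suc n)) → last (Vec.map f v) ≡ f (last v)
last-map f (x ∷ [])     = refl
last-map f (x ∷ y ∷ v) = last-map f (y ∷ v)

rotateRight-∷ʳ : ∀ xs z → rotateRight (xs ++ [ z ]) ≡ z ∷ xs
rotateRight-∷ʳ xs z with reverse (xs ++ [ z ]) | reverse-++ xs [ z ]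
... | _ | refl = cong (z ∷_) (reverse-involutive xs)

rotateRight-map-∷ʳ : ∀ (f : ℕ → ℕ) xs z → rotateRight (map f (xs ++ [ z ])) ≡ f z ∷ map f xs
rotateRight-map-∷ʳ f xs z = trans (cong rotateRight (map-++ f xs [ z ])) (rotateRight-∷ʳ (map f xs) (f z))

IsMin : (ℕ → ℕ) → List ℕ → ℕ → Set
IsMin f A y = y ∈ A × (∀ {z} → z ∈ A → f y ≤ f z)

infix 4 _≋_on_
_≋_on_ : (ℕ → ℕ) → (ℕ → ℕ) → (ℕ → Set) → Set
f ≋ g on P = ∃₂ λ c d → ∀ {z} → P z → f z + c ≡ g z + d

≋-sym : ∀ {f g P} → f ≋ g on P → g ≋ f on P
≋-sym (c , d , f≋g) = d , c , λ pz → sym (f≋g pz)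

≋-mono : ∀ {f g} {P Q : ℕ → Set} → (∀ {z} → Q z → P z) → f ≋ g on P → f ≋ g on Q
≋-mono Q⇒P (c , d , f≋g) = c , d , λ qz → f≋g (Q⇒P qz)

IsMin-≋ : ∀ {f g A y} → f ≋ g on (_∈ A) → IsMin f A y → IsMin g A y
IsMin-≋ (c , d , f≋g) (y∈ , y-min) =
  y∈ , λ z∈ → +-cancelʳ-≤ d _ _ (subst₂ _≤_ (f≋g y∈) (f≋g z∈) (+-monoˡ-≤ c (y-min z∈)))

IsMin-⊆ : ∀ {f A B y} → IsMin f A y → y ∈ B → B ⊆ A → IsMin f B y
IsMin-⊆ (_ , y-min) y∈B B⊆A = y∈B , λ z∈ → y-min (B⊆A z∈)

IsMin-map : ∀ {f g A y} → IsMin (f ∘ g) A y → IsMin f (map g A) (g y)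
IsMin-map {g = g} (y∈ , y-min) = ∈-map⁺ g y∈ , λ z∈ → case ∈-map⁻ g z∈ of λ where
  (z , z∈A , refl) → y-min z∈A

IsMin-unique : ∀ {f A y y′} → (∀ {z w} → z ∈ A → w ∈ A → f z ≡ f w → z ≡ w) →
  IsMin f A y → IsMin f A y′ → y ≡ y′
IsMin-unique f-inj (y∈ , y-min) (y′∈ , y′-min) = f-inj y∈ y′∈ (≤-antisym (y-min y′∈) (y′-min y∈))

pickFirst-just : ∀ p A {y A′} → pickFirst p A ≡ just (y , A′) →
  ∃₂ λ pre post → A ≡ pre ++ y ∷ post × A′ ≡ pre ++ post × All (λ z → p z ≡ false) pre × p y ≡ true
pickFirst-just p (a ∷ as) eq with p a in pa
pickFirst-just p (a ∷ as) refl | true = [] , as , refl , refl , [] , pa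
... | false with pickFirst p as in eq′
pickFirst-just p (a ∷ as) refl | false | just _ with pickFirst-just p as eq′
... | pre , post , refl , refl , before , py = a ∷ pre , post , refl , refl , pa ∷ before , py

pickFirst-nothing : ∀ p A → pickFirst p A ≡ nothing → All (λ z → p z ≡ false) A
pickFirst-nothing p []       _  = []
pickFirst-nothing p (a ∷ as) eq with p a in pa
pickFirst-nothing p (a ∷ as) () | true
... | false with pickFirst p as in eq′
pickFirst-nothing p (a ∷ as) refl | false | nothing = pa ∷ pickFirst-nothing p as eq′

bully-∷ : ∀ x a as → ∃₂ λ y R′ → bully x (a ∷ as) ≡ just (y , R′)
bully-∷ x a as with pickFirst (λ z → x <ᵇ z) (a ∷ as)
... | just (y , R′) = y , R′ , refl
... | nothing       = a , as , refl

runPath-∷ : ∀ {x R rest y R′ e rest′} → bully x R ≡ just (y , R′) → runPath y rest ≡ (just e , rest′) →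
  runPath x (R ∷ rest) ≡ (just e , R′ ∷ rest′)
runPath-∷ {x} {R} {rest} {y} found continue rewrite found | continue = refl

runPath-∷⁻ : ∀ {x R rest e rows′} → runPath x (R ∷ rest) ≡ (just e , rows′) →
  ∃₂ λ y R′ → bully x R ≡ just (y , R′)
    × Σ (List (List ℕ)) λ rest′ → runPath y rest ≡ (just e , rest′) × rows′ ≡ R′ ∷ rest′
runPath-∷⁻ {x} {R} {rest} eq with bully x R in found
... | nothing with () ← eq
... | just (y , R′) with runPath y rest in continue
...   | nothing , _   with () ← eq
...   | just _ , rest′ with refl ← eq = y , R′ , refl , rest′ , continue , refl

runAll-∷ : ∀ r {x xs rows e rows₁} → runPath x rows ≡ (just e , rows₁) →
  runAll r (x ∷ xs) rows ≡ ((e , r) ∷ proj₁ (runAll r xs rows₁) , proj₂ (runAll r xs rows₁))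
runAll-∷ r {x} {xs} {rows} {e} {rows₁} continue rewrite continue with runAll r xs rows₁
... | _ = refl

runAll-labels : ∀ r xs rows → All ((_≡ r) ∘ proj₂) (proj₁ (runAll r xs rows))
runAll-labels r []       rows = []
runAll-labels r (x ∷ xs) rows with runPath x rows
... | nothing , rows₁ = runAll-labels r xs rows₁
... | just _  , rows₁ with runAll r xs rows₁ | runAll-labels r xs rows₁
...   | _ | rest = refl ∷ rest

stages-∷ : ∀ fuel r A B rows → stages (suc fuel) r (A ∷ B ∷ rows) ≡
  proj₁ (runAll r A (B ∷ rows)) ++ stages fuel (suc r) (proj₂ (runAll r A (B ∷ rows)))
stages-∷ fuel r A B rows with runAll r A (B ∷ rows)
... | _ = refl

labelOf-here : ∀ y l L → labelOf y ((y , l) ∷ L) ≡ l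
labelOf-here y l L with (y ≤ᵇ y) ∧ (y ≤ᵇ y) | ≤ᵇ∧≥ᵇ-reflects-≡ y y
... | true  | _        = refl
... | false | ofⁿ y≢y = contradiction refl y≢y

labelOf-there : ∀ {y z} l L → y ≢ z → labelOf y ((z , l) ∷ L) ≡ labelOf y L
labelOf-there {y} {z} l L y≢z with (y ≤ᵇ z) ∧ (z ≤ᵇ y) | ≤ᵇ∧≥ᵇ-reflects-≡ y z
... | false | _        = refl
... | true  | ofʸ y≡z = contradiction y≡z y≢z

labelOf-↭ : ∀ {r y K K′} L → All ((_≡ r) ∘ proj₂) K → K ↭ K′ → labelOf y (K ++ L) ≡ labelOf y (K′ ++ L)
labelOf-↭ L _ ↭-refl-con = refl
labelOf-↭ {y = y} L (_ ∷ Kr) (prep (z , l) p) = cong (λ w → if (y ≤ᵇ z) ∧ (z ≤ᵇ y) then l else w) (labelOf-↭ L Kr p)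
labelOf-↭ {y = y} L (l₁≡r ∷ l₂≡r ∷ Kr) (swap (z₁ , l₁) (z₂ , l₂) p)
  with (y ≤ᵇ z₁) ∧ (z₁ ≤ᵇ y) | (y ≤ᵇ z₂) ∧ (z₂ ≤ᵇ y)
... | true  | true  = trans l₁≡r (sym l₂≡r)
... | true  | false = refl
... | false | true  = refl
... | false | false = labelOf-↭ L Kr p
labelOf-↭ L Kr (↭-trans-con p q) = trans (labelOf-↭ L Kr p) (labelOf-↭ L (All-resp-↭ p Kr) q)

labelOf-∈ : ∀ {y r A} → y ∈ A → labelOf y (map (λ z → z , r) A) ≡ r
labelOf-∈ {y} {r} {a ∷ A} y∈ with y ≟ a
... | yes refl = labelOf-here y r (map (λ z → z , r) A)
... | no  y≢a with y∈
...   | here y≡a  = contradiction y≡a y≢a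
...   | there y∈A = trans (labelOf-there r (map (λ z → z , r) A) y≢a) (labelOf-∈ y∈A)

labelOf-∉ : ∀ {y r A} → y ∉ A → labelOf y (map (λ z → z , r) A) ≡ 0
labelOf-∉ {A = []}    _   = refl
labelOf-∉ {r = r} {a ∷ A} y∉ = trans (labelOf-there r (map (λ z → z , r) A) (y∉ ∘ here)) (labelOf-∉ (y∉ ∘ there))

module Shift (N : ℕ) where

  σ : ℕ → ℕ
  σ = shiftEntry N

  Entry : ℕ → Set
  Entry x = 1 ≤ x × x ≤ N

  entry-cases : ∀ {x} → Entry x → x < N ⊎ x ≡ N
  entry-cases {x} (_ , x≤N) with x <? N
  ... | yes x<N = inj₁ x<N
  ... | no  x≮N = inj₂ (≤-antisym x≤N (≮⇒≥ x≮N))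

  σ-< : ∀ {x} → x < N → σ x ≡ suc x
  σ-< {x} x<N = cong (λ b → if b then suc x else 1) (<ᵇ-true x<N)

  σ-N : σ N ≡ 1
  σ-N = cong (λ b → if b then suc N else 1) (<ᵇ-false (n≮n N))

  σ-entry : ∀ {x} → Entry x → Entry (σ x)
  σ-entry x∈ with entry-cases x∈
  ... | inj₁ x<N rewrite σ-< x<N = s≤s z≤n , x<N
  ... | inj₂ refl rewrite σ-N   = ≤-refl , proj₁ x∈

  σ-injective : ∀ {x y} → Entry x → Entry y → σ x ≡ σ y → x ≡ y
  σ-injective x∈ y∈ eq with entry-cases x∈ | entry-cases y∈
  ... | inj₁ x<N  | inj₁ y<N  = suc-injective (trans (sym (σ-< x<N)) (trans eq (σ-< y<N)))
  ... | inj₁ x<N  | inj₂ refl =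
    contradiction (suc-injective (trans (sym (σ-< x<N)) (trans eq σ-N))) (m<n⇒n≢0 (proj₁ x∈))
  ... | inj₂ refl | inj₁ y<N  =
    contradiction (suc-injective (trans (sym (σ-< y<N)) (trans (sym eq) σ-N))) (m<n⇒n≢0 (proj₁ y∈))
  ... | inj₂ refl | inj₂ refl = refl

  -- Cyclic ranks

  -- Position of z in the cyclic order of 1 … N read from just after x.
  rank : ℕ → ℕ → ℕ
  rank x z = if x <ᵇ z then z else N + z

  rank-true : ∀ {x z} → (x <ᵇ z) ≡ true → rank x z ≡ z
  rank-true {x} {z} = cong (λ b → if b then z else N + z)

  rank-false : ∀ {x z} → (x <ᵇ z) ≡ false → rank x z ≡ N + z
  rank-false {x} {z} = cong (λ b → if b then z else N + z)

  rank-< : ∀ {x z} → x < z → rank x z ≡ z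
  rank-< = rank-true ∘ <ᵇ-true

  rank-≮ : ∀ {x z} → x ≮ z → rank x z ≡ N + z
  rank-≮ = rank-false ∘ <ᵇ-false

  rank-suc : ∀ x z → rank (suc x) (suc z) ≡ suc (rank x z)
  rank-suc x z with x <ᵇ z
  ... | true  = refl
  ... | false = +-suc N z

  entry≢N+entry : ∀ {z w} → Entry z → Entry w → z ≢ N + w
  entry≢N+entry z∈ w∈ = <⇒≢ (≤-<-trans (proj₂ z∈) (m<m+n N (proj₁ w∈)))

  rank-injective : ∀ {x z w} → Entry z → Entry w → rank x z ≡ rank x w → z ≡ w
  rank-injective {x} {z} {w} z∈ w∈ eq with x <? z | x <? w
  ... | yes x<z | yes x<w = trans (sym (rank-< x<z)) (trans eq (rank-< x<w))
  ... | yes x<z | no  x≮w = contradiction (trans (sym (rank-< x<z)) (trans eq (rank-≮ x≮w))) (entry≢N+entry z∈ w∈)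
  ... | no  x≮z | yes x<w = contradiction (trans (sym (rank-< x<w)) (trans (sym eq) (rank-≮ x≮z))) (entry≢N+entry w∈ z∈)
  ... | no  x≮z | no  x≮w = +-cancelˡ-≡ N z w (trans (sym (rank-≮ x≮z)) (trans eq (rank-≮ x≮w)))

  -- σ rotates the cyclic order of the entries by one step.
  rank-σ : ∀ {x} → Entry x → (λ z → rank (σ x) (σ z)) ≋ rank x on Entry
  rank-σ {x} x∈ with entry-cases x∈
  ... | inj₁ x<N = 0 , 1 , λ {z} z∈ → trans (+-identityʳ _) (trans (below z∈) (+-comm 1 (rank x z)))
    where
    below : ∀ {z} → Entry z → rank (σ x) (σ z) ≡ suc (rank x z)
    below {z} z∈ with entry-cases z∈
    ... | inj₁ z<N  rewrite σ-< x<N | σ-< z<N = rank-suc x z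
    ... | inj₂ refl rewrite σ-< x<N | σ-N | rank-< x<N = +-comm N 1
  ... | inj₂ refl = N , 1 , at-N
    where
    at-N : ∀ {z} → Entry z → rank (σ N) (σ z) + N ≡ rank N z + 1
    at-N {z} z∈ with entry-cases z∈
    ... | inj₁ z<N  rewrite σ-N | σ-< z<N | rank-< {1} {suc z} (s≤s (proj₁ z∈)) | rank-≮ (<⇒≯ z<N) =
      trans (cong suc (+-comm z N)) (+-comm 1 (N + z))
    ... | inj₂ refl rewrite σ-N | rank-≮ (n≮n N) =
      trans (+-assoc N 1 N) (trans (cong (N +_) (+-comm 1 N)) (sym (+-assoc N N 1)))

  Row : List ℕ → Set
  Row A = AllPairs _<_ A × All Entry A

  record Removal (R : List ℕ) (y : ℕ) (R′ : List ℕ) : Set where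
    field
      row        : Row R′
      sound      : ∀ {z} → z ∈ R′ → z ∈ R × z ≢ y
      complete   : ∀ {z} → z ∈ R → z ≢ y → z ∈ R′
      length-suc : length R ≡ suc (length R′)

  removal : ∀ pre {y post} → Row (pre ++ y ∷ post) → Removal (pre ++ y ∷ post) y (pre ++ post)
  removal pre (↑ , entries) = record
    { row        = AllPairs-remove pre ↑ , All-remove pre entries
    ; sound      = λ z∈ → ∈-remove⁺ pre z∈ , ∈-remove-≢ pre ↑ z∈
    ; complete   = ∈-remove⁻ pre
    ; length-suc = length-remove pre
    }

  bully-spec : ∀ {x R y R′} → Row R → bully x R ≡ just (y , R′) → IsMin (rank x) R y × Removal R y R′
  bully-spec {x} {R} {y} R-row@(R↑ , R-entries) eq with pickFirst (λ z → x <ᵇ z) R in found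
  ... | just _ with refl ← eq with pickFirst-just _ R found
  ... | pre , post , refl , refl , x≮pre , x<y = (∈-++⁺ʳ pre (here refl) , y-min) , removal pre R-row
    where
    y-min : ∀ {z} → z ∈ pre ++ y ∷ post → rank x y ≤ rank x z
    y-min {z} z∈ rewrite x<y with x <? z
    ... | no  x≮z rewrite rank-≮ x≮z = ≤-trans (proj₂ (All.lookup R-entries (∈-++⁺ʳ pre (here refl)))) (m≤m+n N z)
    ... | yes x<z rewrite rank-< x<z with ∈-++⁻ pre z∈
    ...   | inj₁ z∈pre          = contradiction (trans (sym (<ᵇ-true x<z)) (All.lookup x≮pre z∈pre)) λ ()
    ...   | inj₂ (here refl)    = ≤-refl
    ...   | inj₂ (there z∈post) = <⇒≤ (∈-post⇒> pre R↑ z∈post)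
  bully-spec {x} {R} {y} R-row@(R↑ , _) eq | nothing with pickFirst-just _ R eq
  ... | [] , post , refl , refl , [] , _ = (here refl , y-min) , removal [] R-row
    where
    y-min : ∀ {z} → z ∈ y ∷ post → rank x y ≤ rank x z
    y-min z∈ = let x≮R = pickFirst-nothing _ (y ∷ post) found in
      subst₂ _≤_ (sym (rank-false (All.lookup x≮R (here refl)))) (sym (rank-false (All.lookup x≮R z∈)))
        (+-monoʳ-≤ N (head-≤ R↑ z∈))

  rank-injective-on : ∀ {x A} → Row A → ∀ {z w} → z ∈ A → w ∈ A → rank x z ≡ rank x w → z ≡ w
  rank-injective-on (_ , entries) z∈ w∈ = rank-injective (All.lookup entries z∈) (All.lookup entries w∈)

  IsMin-σ : ∀ {x A y} → Entry x → All Entry A → IsMin (rank x) A y → IsMin (rank (σ x)) (map σ A) (σ y)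
  IsMin-σ x∈ entries y-min = IsMin-map (IsMin-≋ (≋-sym (≋-mono (All.lookup entries) (rank-σ x∈))) y-min)

  -- The shifted procedure

  Shifted : ℕ → ℕ → Set
  Shifted y′ y = y′ ≡ σ y × Entry y

  record ShiftedRow (A′ A : List ℕ) : Set where
    field
      row′    : Row A′
      row     : Row A
      ⊆-shift : A′ ⊆ map σ A
      shift-⊆ : map σ A ⊆ A′

  ShiftedRows : List (List ℕ) → List (List ℕ) → Set
  ShiftedRows = Pointwise ShiftedRow

  ShiftedRow-remove : ∀ {A′ A y B′ B} → ShiftedRow A′ A → Entry y →
    Removal A y B → Removal A′ (σ y) B′ → ShiftedRow B′ B
  ShiftedRow-remove {y = y} S y∈ rem rem′ = record
    { row′    = Removal.row rem′
    ; row     = Removal.row rem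
    ; ⊆-shift = λ z∈ → case Removal.sound rem′ z∈ of λ where
        (z∈A′ , z≢σy) → case ∈-map⁻ σ (⊆-shift z∈A′) of λ where
          (w , w∈A , refl) → ∈-map⁺ σ (Removal.complete rem w∈A (z≢σy ∘ cong σ))
    ; shift-⊆ = λ z∈ → case ∈-map⁻ σ z∈ of λ where
        (w , w∈B , refl) → case Removal.sound rem w∈B of λ where
          (w∈A , w≢y) → Removal.complete rem′ (shift-⊆ (∈-map⁺ σ w∈A))
                          (w≢y ∘ σ-injective (All.lookup (proj₂ row) w∈A) y∈)
    }
    where open ShiftedRow S

  IsMin-shifted : ∀ {x A′ A y y′} → ShiftedRow A′ A → Entry x →
    IsMin (rank x) A y → IsMin (rank (σ x)) A′ y′ → y′ ≡ σ y
  IsMin-shifted S x∈ y-min y′-min = IsMin-unique (rank-injective-on row′) y′-min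
    (IsMin-⊆ (IsMin-σ x∈ (proj₂ row) y-min) (shift-⊆ (∈-map⁺ σ (proj₁ y-min))) ⊆-shift)
    where open ShiftedRow S

  ShiftedBully : ℕ × List ℕ → ℕ × List ℕ → Set
  ShiftedBully (y′ , B′) (y , B) = Shifted y′ y × ShiftedRow B′ B

  bully-σ : ∀ {x A′ A} → Entry x → ShiftedRow A′ A → MaybeRel ShiftedBully (bully (σ x) A′) (bully x A)
  bully-σ {x} {[]}     {[]}    _ _ = nothing
  bully-σ {x} {_ ∷ _}  {[]}    _ S with () ← ShiftedRow.⊆-shift S (here refl)
  bully-σ {x} {[]}     {_ ∷ _} _ S with () ← ShiftedRow.shift-⊆ S (here refl)
  bully-σ {x} {a′ ∷ as′} {a ∷ as} x∈ S
    with bully-∷ (σ x) a′ as′ | bully-∷ x a as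
  ... | y′ , B′ , found′ | y , B , found
    with bully-spec (ShiftedRow.row′ S) found′ | bully-spec (ShiftedRow.row S) found
  ... | y′-min , rem′ | y-min , rem
    with refl ← IsMin-shifted S x∈ y-min y′-min
    rewrite found′ | found
    = just ((refl , y∈) , ShiftedRow-remove S y∈ rem rem′)
    where
    y∈ : Entry y
    y∈ = All.lookup (proj₂ (ShiftedRow.row S)) (proj₁ y-min)

  runPath-σ : ∀ {x rows′ rows} → Entry x → ShiftedRows rows′ rows →
    MaybeRel Shifted (proj₁ (runPath (σ x) rows′)) (proj₁ (runPath x rows))
    × ShiftedRows (proj₂ (runPath (σ x) rows′)) (proj₂ (runPath x rows))
  runPath-σ x∈ [] = just (refl , x∈) , []
  runPath-σ {x} {A′ ∷ rows′} {A ∷ rows} x∈ (S ∷ Ss) with bully (σ x) A′ | bully x A | bully-σ x∈ S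
  ... | nothing | nothing | nothing = nothing , S ∷ Ss
  ... | just (y′ , B′) | just (y , B) | just ((refl , y∈) , S′)
    with runPath (σ y) rows′ | runPath y rows | runPath-σ y∈ Ss
  ... | _ | _ | E , Ss′ = E , S′ ∷ Ss′

  ShiftedLabel : ℕ × ℕ → ℕ × ℕ → Set
  ShiftedLabel (e′ , l′) (e , l) = Shifted e′ e × l′ ≡ l

  runAll-σ : ∀ r {xs rows′ rows} → All Entry xs → ShiftedRows rows′ rows →
    Pointwise ShiftedLabel (proj₁ (runAll r (map σ xs) rows′)) (proj₁ (runAll r xs rows))
    × ShiftedRows (proj₂ (runAll r (map σ xs) rows′)) (proj₂ (runAll r xs rows))
  runAll-σ r [] Ss = [] , Ss
  runAll-σ r {x ∷ xs} {rows′} {rows} (x∈ ∷ xs∈) Ss with runPath (σ x) rows′ | runPath x rows | runPath-σ x∈ Ss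
  ... | nothing , _     | nothing , _    | nothing , Ss₁ = runAll-σ r xs∈ Ss₁
  ... | just _ , rows₁′ | just _ , rows₁ | just E , Ss₁
    with runAll r (map σ xs) rows₁′ | runAll r xs rows₁ | runAll-σ r xs∈ Ss₁
  ... | _ | _ | Ls , Ss₂ = (E , refl) ∷ Ls , Ss₂

  -- Order independence within a row

  -- Measured from the minimiser s of rank a on R, rank a is the cyclic order of R from s.
  rank-from-min : ∀ {a R s} → Row R → IsMin (rank a) R s → rank a ≋ rank (pred s) on (_∈ R)
  rank-from-min {s = zero} (_ , entries) (s∈ , _) with () ← proj₁ (All.lookup entries s∈)
  rank-from-min {a} {R} {suc t} (_ , entries) (_ , s-min) with a <? suc t
  ... | yes a<s = 0 , 0 , λ z∈ → cong (_+ 0) (same z∈)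
    where
    same : ∀ {z} → z ∈ R → rank a z ≡ rank t z
    same {z} z∈ with t <? z
    ... | yes s≤z = trans (rank-< (<-≤-trans a<s s≤z)) (sym (rank-< s≤z))
    ... | no  s≰z with a <? z
    ...   | no  a≮z = trans (rank-≮ a≮z) (sym (rank-≮ s≰z))
    ...   | yes a<z = contradiction (subst₂ _≤_ (rank-< a<s) (rank-< a<z) (s-min z∈)) (<⇒≱ (s≤s (≮⇒≥ s≰z)))
  ... | no a≮s = 0 , N , shifted
    where
    shifted : ∀ {z} → z ∈ R → rank a z + 0 ≡ rank t z + N
    shifted {z} z∈ with a <? z
    ... | yes a<z = contradiction (subst₂ _≤_ (rank-≮ a≮s) (rank-< a<z) (s-min z∈))
                      (<⇒≱ (≤-<-trans (proj₂ (All.lookup entries z∈)) (m<m+n N (s≤s z≤n))))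
    ... | no  a≮z with t <? z
    ...   | yes s≤z rewrite rank-≮ a≮z | rank-< s≤z = trans (+-identityʳ _) (+-comm N z)
    ...   | no  s≰z = contradiction (+-cancelˡ-≤ N _ _ (subst₂ _≤_ (rank-≮ a≮s) (rank-≮ a≮z) (s-min z∈)))
                        (<⇒≱ (s≤s (≮⇒≥ s≰z)))

  IsMin-switch : ∀ {a b R s R₁ y} → Row R → IsMin (rank a) R s → IsMin (rank b) R s →
    R₁ ⊆ R → IsMin (rank a) R₁ y → IsMin (rank b) R₁ y
  IsMin-switch R-row a-min b-min R₁⊆R =
    IsMin-≋ (≋-mono R₁⊆R (≋-sym (rank-from-min R-row b-min))) ∘ IsMin-≋ (≋-mono R₁⊆R (rank-from-min R-row a-min))

  Removal-unique : ∀ {R y R₁ R₂} → Removal R y R₁ → Removal R y R₂ → R₁ ≡ R₂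
  Removal-unique r₁ r₂ =
    increasing-ext (proj₁ (Removal.row r₁)) (proj₁ (Removal.row r₂)) (included r₁ r₂) (included r₂ r₁)
    where
    included : ∀ {R y R₁ R₂} → Removal R y R₁ → Removal R y R₂ → R₁ ⊆ R₂
    included r₁ r₂ z∈ = case Removal.sound r₁ z∈ of λ where
      (z∈R , z≢y) → Removal.complete r₂ z∈R z≢y

  Removal-comm : ∀ {R a R₁ b R₂ R₁′ R₂′} → Removal R a R₁ → Removal R₁ b R₂ →
    Removal R b R₁′ → Removal R₁′ a R₂′ → R₂ ≡ R₂′
  Removal-comm r₁ r₂ r₁′ r₂′ =
    increasing-ext (proj₁ (Removal.row r₂)) (proj₁ (Removal.row r₂′))
      (included r₁ r₂ r₁′ r₂′) (included r₁′ r₂′ r₁ r₂)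
    where
    included : ∀ {R a R₁ b R₂ R₁′ R₂′} → Removal R a R₁ → Removal R₁ b R₂ →
      Removal R b R₁′ → Removal R₁′ a R₂′ → R₂ ⊆ R₂′
    included r₁ r₂ r₁′ r₂′ z∈ with Removal.sound r₂ z∈
    ... | z∈R₁ , z≢b with Removal.sound r₁ z∈R₁
    ...   | z∈R , z≢a = Removal.complete r₂′ (Removal.complete r₁′ z∈R z≢b) z≢a

  -- If x and y hit the same entry first, their second targets coincide too;
  -- otherwise neither disturbs the other.
  bully-comm : ∀ {x y R a R₁ b R₂ b′ R₁′ a′ R₂′} → Row R →
    bully x R ≡ just (a , R₁) → bully y R₁ ≡ just (b , R₂) →
    bully y R ≡ just (b′ , R₁′) → bully x R₁′ ≡ just (a′ , R₂′) →
    R₂ ≡ R₂′ × ((a ≡ b′ × b ≡ a′) ⊎ (a ≡ a′ × b ≡ b′))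
  bully-comm {a = a} {b′ = b′} R-row x-R y-R₁ y-R x-R₁′
    with bully-spec R-row x-R | bully-spec R-row y-R
  ... | a-min , r₁ | b′-min , r₁′
    with bully-spec (Removal.row r₁) y-R₁ | bully-spec (Removal.row r₁′) x-R₁′
  ... | b-min , r₂ | a′-min , r₂′ with a ≟ b′
  ... | yes refl
    with refl ← Removal-unique r₁ r₁′
    with refl ← IsMin-unique (rank-injective-on (Removal.row r₁)) b-min
                  (IsMin-switch R-row a-min b′-min (proj₁ ∘ Removal.sound r₁) a′-min)
    = Removal-unique r₂ r₂′ , inj₁ (refl , refl)
  ... | no a≢b′
    with refl ← IsMin-unique (rank-injective-on (Removal.row r₁′))
                  (IsMin-⊆ a-min (Removal.complete r₁′ (proj₁ a-min) a≢b′) (proj₁ ∘ Removal.sound r₁′)) a′-min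
    with refl ← IsMin-unique (rank-injective-on (Removal.row r₁)) b-min
                  (IsMin-⊆ b′-min (Removal.complete r₁ (proj₁ b′-min) (a≢b′ ∘ sym)) (proj₁ ∘ Removal.sound r₁))
    = Removal-comm r₁ r₂ r₁′ r₂′ , inj₂ (refl , refl)

  runPath-comm : ∀ {x y rows ex rows₁ ey rows₂ fy rows₁′ fx rows₂′} → All Row rows →
    runPath x rows ≡ (just ex , rows₁) → runPath y rows₁ ≡ (just ey , rows₂) →
    runPath y rows ≡ (just fy , rows₁′) → runPath x rows₁′ ≡ (just fx , rows₂′) →
    rows₂ ≡ rows₂′ × ((ex ≡ fy × ey ≡ fx) ⊎ (ex ≡ fx × ey ≡ fy))
  runPath-comm [] refl refl refl refl = refl , inj₂ (refl , refl)
  runPath-comm (R-row ∷ rest-rows) x-rows y-rows₁ y-rows x-rows₁′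
    with runPath-∷⁻ x-rows | runPath-∷⁻ y-rows
  ... | a , _ , x-R , _ , a-rest , refl | b′ , _ , y-R , _ , b′-rest , refl
    with runPath-∷⁻ y-rows₁ | runPath-∷⁻ x-rows₁′
  ... | b , _ , y-R₁ , _ , b-rest₁ , refl | a′ , _ , x-R₁′ , _ , a′-rest₁′ , refl
    with bully-comm R-row x-R y-R₁ y-R x-R₁′
  ... | refl , inj₁ (refl , refl)
    with refl ← trans (sym a-rest) b′-rest
    with refl ← trans (sym b-rest₁) a′-rest₁′
    = refl , inj₁ (refl , refl)
  ... | refl , inj₂ (refl , refl) with runPath-comm rest-rows a-rest b-rest₁ b′-rest a′-rest₁′
  ...   | refl , endpoints = refl , endpoints

  Cap : ℕ → List (List ℕ) → Set
  Cap k rows = All (k ≤_) (map length rows)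

  runPath-succeeds : ∀ {x rows} → All Row rows → Cap 1 rows →
    ∃₂ λ e rows′ → runPath x rows ≡ (just e , rows′) × All Row rows′ × map length rows ≡ map suc (map length rows′)
  runPath-succeeds {x} {[]} [] [] = x , [] , refl , [] , refl
  runPath-succeeds {x} {(a ∷ as) ∷ rest} (R-row ∷ rest-rows) (_ ∷ cap)
    with bully-∷ x a as
  ... | y , R′ , found with bully-spec R-row found | runPath-succeeds {y} rest-rows cap
  ... | _ , r | e , rest′ , continue , rest′-rows , lengths =
    e , R′ ∷ rest′ , runPath-∷ found continue , Removal.row r ∷ rest′-rows , cong₂ _∷_ (Removal.length-suc r) lengths

  Cap-suc⁻ : ∀ {k rows rows′} → Cap (suc k) rows → map length rows ≡ map suc (map length rows′) → Cap k rows′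
  Cap-suc⁻ cap lengths = All.map s≤s⁻¹ (All.map⁻ (subst (All _) lengths cap))

  Cap-mono : ∀ {j k rows} → j ≤ k → Cap k rows → Cap j rows
  Cap-mono j≤k = All.map (≤-trans j≤k)

  runAll-rows : ∀ r {xs rows} → All Row rows → Cap (length xs) rows →
    All Row (proj₂ (runAll r xs rows))
    × map length rows ≡ map (length xs +_) (map length (proj₂ (runAll r xs rows)))
  runAll-rows r {[]} rows-ok _ = rows-ok , sym (map-id _)
  runAll-rows r {x ∷ xs} {rows} rows-ok cap with runPath-succeeds {x} rows-ok (Cap-mono (s≤s z≤n) cap)
  ... | e , rows₁ , continue , rows₁-ok , lengths with runAll-rows r {xs} rows₁-ok (Cap-suc⁻ cap lengths)
  ... | rows₂-ok , lengths′ =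
    subst (λ run → All Row (proj₂ run) × map length rows ≡ map (suc (length xs) +_) (map length (proj₂ run)))
      (sym (runAll-∷ r {x} {xs} {rows} continue))
      (rows₂-ok , trans lengths (trans (cong (map suc) lengths′) (sym (map-∘ _))))

  SameRun : List (ℕ × ℕ) × List (List ℕ) → List (ℕ × ℕ) × List (List ℕ) → Set
  SameRun (labels , rows) (labels′ , rows′) = labels ↭ labels′ × rows ≡ rows′

  runAll-↭ : ∀ r {xs ys rows} → xs ↭ ys → All Row rows → Cap (length xs) rows →
    SameRun (runAll r xs rows) (runAll r ys rows)
  runAll-↭ r ↭-refl-con _ _ = ↭-refl , refl
  runAll-↭ r {x ∷ xs} {x ∷ ys} {rows} (prep x p) rows-ok cap
    with runPath-succeeds {x} rows-ok (Cap-mono (s≤s z≤n) cap)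
  ... | e , rows₁ , continue , rows₁-ok , lengths
    with runAll-↭ r p rows₁-ok (Cap-suc⁻ cap lengths)
  ... | perm , same =
    subst₂ SameRun (sym (runAll-∷ r {x} {xs} {rows} continue)) (sym (runAll-∷ r {x} {ys} {rows} continue)) (prep (e , r) perm , same)
  runAll-↭ r {x ∷ y ∷ xs} {y ∷ x ∷ ys} {rows} (swap x y p) rows-ok cap
    with runPath-succeeds {x} rows-ok (Cap-mono (s≤s z≤n) cap)
  ... | ex , rows₁ , x-rows , rows₁-ok , lengths₁
    with runPath-succeeds {y} rows₁-ok (Cap-mono (s≤s z≤n) (Cap-suc⁻ cap lengths₁))
  ... | ey , rows₂ , y-rows₁ , rows₂-ok , lengths₂
    with runPath-succeeds {y} rows-ok (Cap-mono (s≤s z≤n) cap)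
  ... | fy , rows₁′ , y-rows , rows₁′-ok , lengths₁′
    with runPath-succeeds {x} rows₁′-ok (Cap-mono (s≤s z≤n) (Cap-suc⁻ cap lengths₁′))
  ... | fx , rows₂′ , x-rows₁′ , _ , _
    with runPath-comm rows-ok x-rows y-rows₁ y-rows x-rows₁′
  ... | refl , endpoints
    with runAll-↭ r p rows₂-ok (Cap-suc⁻ (Cap-suc⁻ cap lengths₁) lengths₂)
  ... | perm , same =
    subst₂ SameRun
      (sym (trans (runAll-∷ r {x} {y ∷ xs} {rows} x-rows)
                  (cong (λ run → (ex , r) ∷ proj₁ run , proj₂ run) (runAll-∷ r {y} {xs} {rows₁} y-rows₁))))
      (sym (trans (runAll-∷ r {y} {x ∷ ys} {rows} y-rows)
                  (cong (λ run → (fy , r) ∷ proj₁ run , proj₂ run) (runAll-∷ r {x} {ys} {rows₁′} x-rows₁′))))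
      (two-labels-↭ endpoints perm , same)
    where
    two-labels-↭ : ∀ {a b c d L L′} → (a ≡ c × b ≡ d) ⊎ (a ≡ d × b ≡ c) → L ↭ L′ →
      (a , r) ∷ (b , r) ∷ L ↭ (c , r) ∷ (d , r) ∷ L′
    two-labels-↭ (inj₁ (refl , refl)) perm = prep _ (prep _ perm)
    two-labels-↭ (inj₂ (refl , refl)) perm = swap _ _ perm
  runAll-↭ r (↭-trans-con p q) rows-ok cap with runAll-↭ r p rows-ok cap
  ... | perm₁ , same₁ with runAll-↭ r q rows-ok (subst (λ k → Cap k _) (↭-length p) cap)
  ... | perm₂ , same₂ = ↭-trans perm₁ perm₂ , trans same₁ same₂

  -- Sorting a shifted row

  σ-<-mono : ∀ {a b} → a < b → b < N → σ a < σ b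
  σ-<-mono a<b b<N rewrite σ-< (<-trans a<b b<N) | σ-< b<N = s≤s a<b

  σ-increasing : ∀ {A} → AllPairs _<_ A → All (_< N) A → AllPairs _<_ (map σ A)
  σ-increasing []           []         = []
  σ-increasing (a<A ∷ A↑) (_ ∷ A<N) = All.map⁺ (All.zipWith (uncurry σ-<-mono) (a<A , A<N)) ∷ σ-increasing A↑ A<N

  shift-increasing-∉ : ∀ {A} → Row A → N ∉ A → AllPairs _<_ (map σ A)
  shift-increasing-∉ (A↑ , entries) N∉A =
    σ-increasing A↑ (All.tabulate λ z∈ → ≤∧≢⇒< (proj₂ (All.lookup entries z∈)) λ { refl → N∉A z∈ })

  -- σ sends N to 1, so the shifted row starts with it.
  shift-increasing-∈ : ∀ {ini} → Row (ini ++ [ N ]) → AllPairs _<_ (map σ (N ∷ ini))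
  shift-increasing-∈ {ini} (A↑ , entries) =
    All.map⁺ (All.tabulate σN<σz) ∷ σ-increasing (AllPairs-++⁻ˡ ini A↑) (All.tabulate (∈-pre⇒< ini A↑))
    where
    σN<σz : ∀ {z} → z ∈ ini → σ N < σ z
    σN<σz z∈ rewrite σ-N | σ-< (∈-pre⇒< ini A↑ z∈) = s≤s (proj₁ (All.lookup (All.++⁻ˡ ini entries) z∈))

  N-last : ∀ {A} → Row A → N ∈ A → ∃ λ ini → A ≡ ini ++ [ N ]
  N-last {_ ∷ []}    _                                     (here refl) = [] , refl
  N-last {_ ∷ _ ∷ _} ((N<b ∷ _) ∷ _ , _ ∷ (_ , b≤N) ∷ _) (here refl) = contradiction b≤N (<⇒≱ N<b)
  N-last {a ∷ _}     ((_ ∷ A↑) , (_ ∷ entries))            (there N∈) with N-last (A↑ , entries) N∈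
  ... | ini , refl = a ∷ ini , refl

  increasing-shift-order : ∀ {A} → Row A → ∃ λ P → P ↭ A × AllPairs _<_ (map σ P)
  increasing-shift-order {A} A-row with N ∈? A
  ... | no  N∉A = A , ↭-refl , shift-increasing-∉ A-row N∉A
  ... | yes N∈A with N-last A-row N∈A
  ...   | ini , refl = N ∷ ini , ∷↭∷ʳ N ini , shift-increasing-∈ A-row

  sort-shift : ∀ {A P} → P ↭ A → AllPairs _<_ (map σ P) → sort (map σ A) ≡ map σ P
  sort-shift P↭A P↑ = sort-unique (Linked.map <⇒≤ (Linked.AllPairs⇒Linked P↑)) (↭.map⁺ σ (↭-sym P↭A))

  ShiftedRow-sort : ∀ {A} → Row A → ShiftedRow (sort (map σ A)) A
  ShiftedRow-sort {A} A-row@(_ , entries) with increasing-shift-order A-row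
  ... | P , P↭A , P↑ rewrite sort-shift P↭A P↑ = record
    { row′    = P↑ , All.map⁺ (All.map σ-entry (All-resp-↭ (↭-sym P↭A) entries))
    ; row     = A-row
    ; ⊆-shift = ∈-resp-↭ (↭.map⁺ σ P↭A)
    ; shift-⊆ = ∈-resp-↭ (↭.map⁺ σ (↭-sym P↭A))
    }

  ShiftedRow-canonical : ∀ {A′ A P} → ShiftedRow A′ A → P ↭ A → AllPairs _<_ (map σ P) → A′ ≡ map σ P
  ShiftedRow-canonical S P↭A P↑ = increasing-ext (proj₁ row′) P↑
    (∈-resp-↭ (↭.map⁺ σ (↭-sym P↭A)) ∘ ⊆-shift) (shift-⊆ ∘ ∈-resp-↭ (↭.map⁺ σ P↭A))
    where open ShiftedRow S

  SameLabels : List (ℕ × ℕ) → List (ℕ × ℕ) → Set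
  SameLabels L′ L = ∀ {y} → Entry y → labelOf (σ y) L′ ≡ labelOf y L

  SameLabels-++ : ∀ {K′ K L′ L} → Pointwise ShiftedLabel K′ K → SameLabels L′ L → SameLabels (K′ ++ L′) (K ++ L)
  SameLabels-++ [] same = same
  SameLabels-++ {(_ , l) ∷ K′} {(e , _) ∷ K} {L′} {L} (((refl , e∈) , refl) ∷ Ks) same {y} y∈ with y ≟ e
  ... | yes refl = trans (labelOf-here (σ y) l (K′ ++ L′)) (sym (labelOf-here y l (K ++ L)))
  ... | no  y≢e  = trans (labelOf-there l (K′ ++ L′) (y≢e ∘ σ-injective y∈ e∈))
                     (trans (SameLabels-++ Ks same y∈) (sym (labelOf-there l (K ++ L) y≢e)))

  ShiftedRow-labels : ∀ {r A′ A} → ShiftedRow A′ A → SameLabels (map (λ z → z , r) A′) (map (λ z → z , r) A)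
  ShiftedRow-labels {A = A} S {y} y∈ with y ∈? A
  ... | yes y∈A = trans (labelOf-∈ (shift-⊆ (∈-map⁺ σ y∈A))) (sym (labelOf-∈ y∈A))
    where open ShiftedRow S
  ... | no  y∉A = trans (labelOf-∉ σy∉A′) (sym (labelOf-∉ y∉A))
    where
    open ShiftedRow S
    σy∉A′ : σ y ∉ _
    σy∉A′ σy∈ with ∈-map⁻ σ (⊆-shift σy∈)
    ... | w , w∈A , σy≡σw = y∉A (subst (_∈ A) (sym (σ-injective y∈ (All.lookup (proj₂ row) w∈A) σy≡σw)) w∈A)

  ShiftedRows-rows : ∀ {rows′ rows} → ShiftedRows rows′ rows → All Row rows
  ShiftedRows-rows []       = []
  ShiftedRows-rows (S ∷ Ss) = ShiftedRow.row S ∷ ShiftedRows-rows Ss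

  stages-σ : ∀ fuel r {rows′ rows} → ShiftedRows rows′ rows → Linked _≤_ (map length rows) →
    SameLabels (stages fuel r rows′) (stages fuel r rows)
  stages-σ fuel       r []          _ _ = refl
  stages-σ fuel       r (S ∷ [])    _   = ShiftedRow-labels S
  stages-σ zero       r (_ ∷ _ ∷ _) _ _ = refl
  stages-σ (suc fuel) r {A′ ∷ B′ ∷ rows′} {A ∷ B ∷ rows} (S ∷ Ss@(_ ∷ _)) (lA≤lB ∷ lengths↗) {y} y∈
    with increasing-shift-order (ShiftedRow.row S)
  ... | P , P↭A , P↑ with refl ← ShiftedRow-canonical S P↭A P↑ = begin
      labelOf (σ y) (stages (suc fuel) r (map σ P ∷ B′ ∷ rows′))
    ≡⟨ cong (labelOf (σ y)) (stages-∷ fuel r (map σ P) B′ rows′) ⟩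
      labelOf (σ y) (proj₁ run′ ++ stages fuel (suc r) (proj₂ run′))
    ≡⟨ SameLabels-++ (proj₁ σ-run) (stages-σ fuel (suc r) (proj₂ σ-run) rest↗) y∈ ⟩
      labelOf y (proj₁ runP ++ stages fuel (suc r) (proj₂ runP))
    ≡⟨ labelOf-↭ (stages fuel (suc r) (proj₂ runP)) (runAll-labels r P (B ∷ rows)) (proj₁ same-run) ⟩
      labelOf y (proj₁ runA ++ stages fuel (suc r) (proj₂ runP))
    ≡⟨ cong (λ rest → labelOf y (proj₁ runA ++ stages fuel (suc r) rest)) (proj₂ same-run) ⟩
      labelOf y (proj₁ runA ++ stages fuel (suc r) (proj₂ runA))
    ≡⟨ cong (labelOf y) (stages-∷ fuel r A B rows) ⟨
      labelOf y (stages (suc fuel) r (A ∷ B ∷ rows))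
    ∎
    where
    run′ runP runA : List (ℕ × ℕ) × List (List ℕ)
    run′ = runAll r (map σ P) (B′ ∷ rows′)
    runP = runAll r P (B ∷ rows)
    runA = runAll r A (B ∷ rows)
    rest-ok : All Row (B ∷ rows)
    rest-ok = ShiftedRows-rows Ss
    cap : Cap (length P) (B ∷ rows)
    cap = subst (λ k → Cap k (B ∷ rows)) (sym (↭-length P↭A)) (Linked.Linked⇒All ≤-trans lA≤lB lengths↗)
    σ-run : Pointwise ShiftedLabel (proj₁ run′) (proj₁ runP) × ShiftedRows (proj₂ run′) (proj₂ runP)
    σ-run = runAll-σ r (All-resp-↭ (↭-sym P↭A) (proj₂ (ShiftedRow.row S))) Ss
    same-run : SameRun runP runA
    same-run = runAll-↭ r P↭A rest-ok cap
    rest↗ : Linked _≤_ (map length (proj₂ runP))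
    rest↗ = Linked-+⁻ (length P) (subst (Linked _≤_) (proj₂ (runAll-rows r {P} rest-ok cap)) lengths↗)

  ShiftedRows-sort : ∀ {rows} → All Row rows → ShiftedRows (map (λ row → sort (map σ row)) rows) rows
  ShiftedRows-sort []               = []
  ShiftedRows-sort (R-row ∷ rows-ok) = ShiftedRow-sort R-row ∷ ShiftedRows-sort rows-ok

  allLabels-shift : ∀ {k} (M : Vec (List ℕ) (suc k)) → All Row (toList M) → Linked _≤_ (map length (toList M)) →
    SameLabels (allLabels (shiftM N M)) (allLabels M)
  allLabels-shift {k} M rows-ok lengths↗ =
    subst (λ rows′ → SameLabels (stages (suc k) 1 rows′) (allLabels M)) (sym (toList-map _ M))
      (stages-σ (suc k) 1 (ShiftedRows-sort rows-ok) lengths↗)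

  projWord-shift : ∀ {k} (M : Vec (List ℕ) (suc k)) → All Row (toList M) → Linked _≤_ (map length (toList M)) →
    ∀ {P} → P ↭ last M → AllPairs _<_ (map σ P) → projWord (shiftM N M) ≡ map (λ y → labelOf y (allLabels M)) P
  projWord-shift M rows-ok lengths↗ {P} P↭ P↑ = begin
      projWord (shiftM N M)
    ≡⟨ cong (map label′) (trans (last-map _ M) (sort-shift P↭ P↑)) ⟩
      map label′ (map σ P)
    ≡⟨ map-∘ P ⟨
      map (label′ ∘ σ) P
    ≡⟨ map-cong-local (All.map (allLabels-shift M rows-ok lengths↗) (All-resp-↭ (↭-sym P↭) last-entries)) ⟩
      map (λ y → labelOf y (allLabels M)) P
    ∎
    where
    label′ : ℕ → ℕ
    label′ y = labelOf y (allLabels (shiftM N M))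
    last-entries : All Entry (last M)
    last-entries = proj₂ (All.lookup rows-ok (last-∈ M))

IsCMLQ-rows : ∀ {n} {m : Vec ℕ n} {M} → IsCMLQ m M → All (Shift.Row (totalN m)) (toList M)
IsCMLQ-rows {m = m} {M} cmlq = All.tabulate λ R∈ →
  Linked.Linked⇒AllPairs <-trans (All.lookup rowsIncr R∈) , All.tabulate λ z∈ → entry (∈-concat⁺′ z∈ R∈)
  where
  open IsCMLQ cmlq
  entry : ∀ {z} → z ∈ concat (toList M) → Shift.Entry (totalN m) z
  entry z∈ with ∈-map⁻ suc (∈-resp-↭ entries z∈)
  ... | i , i∈ , refl = s≤s z≤n , ∈-upTo⁻ i∈

IsCMLQ-lengths↗ : ∀ {n} {m : Vec ℕ n} {M} → IsCMLQ m M → Linked _≤_ (map length (toList M))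
IsCMLQ-lengths↗ {m = m} cmlq = subst (Linked _≤_) (sym (IsCMLQ.rowLengths cmlq)) (partialSums-↗ (toList m))

lemma2p8 : ∀ {k : ℕ} (m : Vec ℕ (suc k)) (M : Vec (List ℕ) (suc k)) → IsCMLQ m M →
    (¬ (totalN m ∈ last M) → projWord (shiftM (totalN m) M) ≡ projWord M)
    × (totalN m ∈ last M → projWord (shiftM (totalN m) M) ≡ rotateRight (projWord M))
lemma2p8 m M cmlq = unchanged , rotated
  where
  N : ℕ
  N = totalN m
  open Shift N

  last-ok : Row (last M)
  last-ok = All.lookup (IsCMLQ-rows cmlq) (last-∈ M)

  label : ℕ → ℕ
  label y = labelOf y (allLabels M)

  word-shift : ∀ {P} → P ↭ last M → AllPairs _<_ (map σ P) → projWord (shiftM N M) ≡ map label P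
  word-shift = projWord-shift M (IsCMLQ-rows cmlq) (IsCMLQ-lengths↗ cmlq)

  unchanged : N ∉ last M → projWord (shiftM N M) ≡ projWord M
  unchanged N∉ = word-shift ↭-refl (shift-increasing-∉ last-ok N∉)

  rotated : N ∈ last M → projWord (shiftM N M) ≡ rotateRight (projWord M)
  rotated N∈ with N-last last-ok N∈
  ... | ini , last≡ = trans
    (word-shift (↭-trans (∷↭∷ʳ N ini) (↭-reflexive (sym last≡))) (shift-increasing-∈ (subst Row last≡ last-ok)))
    (sym (trans (cong (rotateRight ∘ map label) last≡) (rotateRight-map-∷ʳ label ini N)))
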